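{- Consider peg solitaire on Wiegleb's 45-hole board, and let $s \in \{d6, g6\}$. Start with a man in every hole except $s$. Then there is a legal sequence of moves that ends with a single man at d3, in which the penultimate move is the 16-jump sweep d2-f2-f4-h4-h6-f6-f8-d8-d6-d4-f4-f6-d6-b6-b4-d4-d2.
   Context: Wiegleb's board has columns labelled a–i and rows numbered 1–9. Its holes are all holes in columns d, e, f (rows 1–9) together with all holes in rows 4, 5, 6 (columns a–i), 45 holes in total. Peg solitaire rules: each hole is either empty or holds one man. A jump takes a man from a hole X over an orthogonally adjacent occupied hole Y into the empty hole Z immediately beyond Y on the same line; the man at Y is removed. A jump is written X-Z. A move is a sequence of one or more consecutive jumps made by the same man, written X-Z-W-... -}

module Defs where

open import Data.Bool using (Bool; true; false; _∧_; _∨_; not; if_then_else_; T)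
open import Data.Nat using (ℕ; _≡ᵇ_; _≤ᵇ_; _+_; ⌊_/2⌋)
open import Data.Product using (_×_; _,_)
open import Data.List using (List; []; _∷_)
open import Data.List.NonEmpty using (List⁺; _∷_)
open import Data.Maybe using (Maybe; just; nothing; _>>=_)

-- Coordinates: column a..i ↦ 1..9, row 1..9 ↦ 1..9.
Pos : Set
Pos = ℕ × ℕ

_==_ : Pos → Pos → Bool
(c , r) == (c' , r') = (c ≡ᵇ c') ∧ (r ≡ᵇ r')

inRange : ℕ → ℕ → ℕ → Bool
inRange lo hi n = (lo ≤ᵇ n) ∧ (n ≤ᵇ hi)

isHole : Pos → Bool
isHole (c , r) = (inRange 4 6 c ∧ inRange 1 9 r) ∨ (inRange 4 6 r ∧ inRange 1 9 c)

-- A position: true = hole holds a man.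
Board : Set
Board = Pos → Bool

set : Board → Pos → Bool → Board
set b p v q = if q == p then v else b q

twoApart : Pos → Pos → Bool
twoApart (x , y) (x' , y') =
  ((x ≡ᵇ x') ∧ ((y' ≡ᵇ y + 2) ∨ (y ≡ᵇ y' + 2))) ∨
  ((y ≡ᵇ y') ∧ ((x' ≡ᵇ x + 2) ∨ (x ≡ᵇ x' + 2)))

mid : Pos → Pos → Pos
mid (x , y) (x' , y') = ⌊ x + x' /2⌋ , ⌊ y + y' /2⌋

jump : Board → Pos → Pos → Maybe Board
jump b X Z =
  let Y = mid X Z in
  if twoApart X Z ∧ isHole X ∧ isHole Y ∧ isHole Z ∧ b X ∧ b Y ∧ not (b Z)
  then just (set (set (set b X false) Y false) Z true)
  else nothing

Move : Set
Move = Pos × List⁺ Pos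

jumpsFrom : Board → Pos → List Pos → Maybe Board
jumpsFrom b X [] = just b
jumpsFrom b X (Z ∷ Zs) = jump b X Z >>= λ b' → jumpsFrom b' Z Zs

playMove : Board → Move → Maybe Board
playMove b (X , Z ∷ Zs) = jump b X Z >>= λ b' → jumpsFrom b' Z Zs

play : Board → List Move → Maybe Board
play b [] = just b
play b (m ∷ ms) = playMove b m >>= λ b' → play b' ms

d6 g6 d3 : Pos
d6 = 4 , 6
g6 = 7 , 6
d3 = 4 , 3

startBoard : Pos → Board
startBoard s p = isHole p ∧ not (p == s)

SingleManAt : Pos → Board → Set
SingleManAt p b = ∀ q → T (isHole q) → b q ≡ (q == p)
  where open import Relation.Binary.PropositionalEquality using (_≡_)

sweep : Move
sweep = (4 , 2) ,
  (6 , 2) ∷ (6 , 4) ∷ (8 , 4) ∷ (8 , 6) ∷ (6 , 6) ∷ (6 , 8) ∷ (4 , 8) ∷ (4 , 6) ∷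
  (4 , 4) ∷ (6 , 4) ∷ (6 , 6) ∷ (4 , 6) ∷ (2 , 6) ∷ (2 , 4) ∷ (4 , 4) ∷ (4 , 2) ∷ []

{-# OPTIONS --safe #-}
-- Both openings, f6-d6 when s = d6 and e6-g6 when s = g6, leave every hole filled except
-- e6 and f6, so one continuation serves both cases: 25 single jumps, the sweep, and d1-d3.
-- Legality of the play is checked by evaluation; that the final board has a single man is a
-- finite check, because every hole has both coordinates below 10.
module Submission where

open import Defs
open import Data.Bool using (T; _∧_)
open import Data.Bool.Properties using (T-∧; T-∨) renaming (_≟_ to _≟ᵇ_)
open import Data.List using (List; _∷_; []; _++_)
open import Data.List.NonEmpty using (_∷_)
open import Data.Maybe using (Maybe; just; nothing)
open import Data.Nat using (ℕ; _≤_; _<_; _≤ᵇ_; s≤s)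
open import Data.Nat.Properties using (≤ᵇ⇒≤; ≤-trans; m≤n+m; allUpTo?)
open import Data.Product using (Σ; _×_; _,_; proj₂)
open import Data.Sum using (_⊎_; inj₁; inj₂)
open import Data.Unit using (tt)
open import Function.Bundles using (module Equivalence)
open import Relation.Nullary.Decidable using (Dec; no; map′; T?; _→-dec_; toWitness)
open import Relation.Binary.PropositionalEquality using (_≡_; refl)

open Equivalence using (to)

inRange⇒≤ : ∀ lo hi n → T (inRange lo hi n) → n ≤ hi
inRange⇒≤ lo hi n h = ≤ᵇ⇒≤ n hi (proj₂ (to (T-∧ {lo ≤ᵇ n}) h))

isHole⇒<10 : ∀ c r → T (isHole (c , r)) → c < 10 × r < 10
isHole⇒<10 c r h with to (T-∨ {inRange 4 6 c ∧ inRange 1 9 r}) h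
... | inj₁ h′ with to (T-∧ {inRange 4 6 c}) h′
...   | c-in , r-in = s≤s (≤-trans (inRange⇒≤ 4 6 c c-in) (m≤n+m 6 3)) , s≤s (inRange⇒≤ 1 9 r r-in)
isHole⇒<10 c r h | inj₂ h′ with to (T-∧ {inRange 4 6 r}) h′
...   | r-in , c-in = s≤s (inRange⇒≤ 1 9 c c-in) , s≤s (≤-trans (inRange⇒≤ 4 6 r r-in) (m≤n+m 6 3))

singleManAt? : ∀ p b → Dec (SingleManAt p b)
singleManAt? p b = map′ fromGrid toGrid (allUpTo? (λ c → allUpTo? (ok? c) 10) 10)
  where
  Ok : ℕ → ℕ → Set
  Ok c r = T (isHole (c , r)) → b (c , r) ≡ ((c , r) == p)

  ok? : ∀ c r → Dec (Ok c r)
  ok? c r = T? (isHole (c , r)) →-dec (b (c , r) ≟ᵇ ((c , r) == p))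

  fromGrid : (∀ {c} → c < 10 → ∀ {r} → r < 10 → Ok c r) → SingleManAt p b
  fromGrid ok (c , r) h with isHole⇒<10 c r h
  ... | c<10 , r<10 = ok c<10 r<10 h

  toGrid : SingleManAt p b → ∀ {c} → c < 10 → ∀ {r} → r < 10 → Ok c r
  toGrid single {c} _ {r} _ = single (c , r)

EndsWithSingleManAt : Pos → Maybe Board → Set
EndsWithSingleManAt p result = Σ Board λ b → result ≡ just b × SingleManAt p b

endsWithSingleManAt? : ∀ p result → Dec (EndsWithSingleManAt p result)
endsWithSingleManAt? p nothing = no λ ()
endsWithSingleManAt? p (just b) =
  map′ (λ single → b , refl , single) (λ { (_ , refl , single) → single }) (singleManAt? p b)

_⟶_ : Pos → Pos → Move
X ⟶ Z = X , Z ∷ []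

opening-d6 opening-g6 : Move
opening-d6 = (6 , 6) ⟶ (4 , 6)
opening-g6 = (5 , 6) ⟶ (7 , 6)

clearing : List Move
clearing =
  (8 , 6) ⟶ (6 , 6) ∷ (7 , 4) ⟶ (7 , 6) ∷ (9 , 4) ⟶ (7 , 4) ∷ (9 , 6) ⟶ (9 , 4) ∷
  (6 , 4) ⟶ (8 , 4) ∷ (9 , 4) ⟶ (7 , 4) ∷ (3 , 6) ⟶ (5 , 6) ∷ (4 , 8) ⟶ (4 , 6) ∷
  (6 , 7) ⟶ (4 , 7) ∷ (6 , 9) ⟶ (6 , 7) ∷ (6 , 6) ⟶ (6 , 8) ∷ (4 , 9) ⟶ (6 , 9) ∷
  (6 , 9) ⟶ (6 , 7) ∷ (3 , 4) ⟶ (3 , 6) ∷ (1 , 5) ⟶ (3 , 5) ∷ (4 , 5) ⟶ (2 , 5) ∷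
  (4 , 3) ⟶ (4 , 5) ∷ (6 , 3) ⟶ (4 , 3) ∷ (6 , 1) ⟶ (6 , 3) ∷ (5 , 1) ⟶ (5 , 3) ∷
  (5 , 4) ⟶ (5 , 2) ∷ (5 , 6) ⟶ (5 , 4) ∷ (3 , 6) ⟶ (5 , 6) ∷ (1 , 6) ⟶ (3 , 6) ∷
  (1 , 4) ⟶ (3 , 4) ∷ []

finale : Move
finale = (4 , 1) ⟶ (4 , 3)

mainTheorem4 : (s : Pos) → s ≡ d6 ⊎ s ≡ g6 →
    Σ (List Move) λ pre → Σ Move λ last → Σ Board λ b →
    play (startBoard s) (pre ++ sweep ∷ last ∷ []) ≡ just b × SingleManAt d3 b
mainTheorem4 _ (inj₁ refl) =
  opening-d6 ∷ clearing , finale , toWitness {a? = endsWithSingleManAt? d3 _} tt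
mainTheorem4 _ (inj₂ refl) =
  opening-g6 ∷ clearing , finale , toWitness {a? = endsWithSingleManAt? d3 _} tt
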